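{- Let $F\colon (L+\{\tau\})\to[S\to\mathcal P S]$ and $G\colon (L+\{\tau\})\to[T\to\mathcal P T]$ be labelled transition systems with internal action $\tau$, and let $R\subseteq S\times T$. Then $R$ is a semi-branching bisimulation if and only if $(F^{sb},G^{sb})\in \mathrm{Id}_{L+\{\tau\}}\to[R\to\mathcal P(R\times R)]$, i.e. for every $a\in L+\{\tau\}$ and all $s,t$ with $sRt$, $F^{sb}(a)(s)\,[\mathcal P(R\times R)]\,G^{sb}(a)(t)$.
   Context: $L$ is a set of labels not containing $\tau$; write $s\xrightarrow{a}s'$ for $s'\in F(a)(s)$. Write $x\xrightarrow{\tau^*}y$ iff there is a finite, possibly empty, sequence $x\xrightarrow{\tau}\cdots\xrightarrow{\tau}y$ (with $x=y$ if empty). $R\subseteq S\times T$ is a semi-branching bisimulation iff whenever $sRt$: (i) $s\xrightarrow{a}s'$ implies that either there exist $t_1,t_2\in T$ with $t\xrightarrow{\tau^*}t_1\xrightarrow{a}t_2$, $sRt_1$, $s'Rt_2$, or ($a=\tau$ and there is $t'\in T$ with $t\xrightarrow{\tau^*}t'$, $sRt'$ and $s'Rt'$); (ii) $t\xrightarrow{a}t'$ implies that either there exist $s_1,s_2\in S$ with $s\xrightarrow{\tau^*}s_1\xrightarrow{a}s_2$, $s_1Rt$, $s_2Rt'$, or ($a=\tau$ and there is $s'\in S$ with $s\xrightarrow{\tau^*}s'$, $s'Rt$ and $s'Rt'$). The semi-branching saturation $F^{sb}\colon (L+\{\tau\})\to[S\to\mathcal P(S\times S)]$ is $F^{sb}(a)(s)=\{(s_1,s_2)\mid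 s\xrightarrow{\tau^*}s_1\xrightarrow{a}s_2,\text{ or }(a=\tau,\ s_1=s_2\text{ and } s\xrightarrow{\tau^*}s_1)\}$, similarly $G^{sb}$. $R\times R$ relates $(s_1,s_2)$ to $(t_1,t_2)$ iff $s_1Rt_1$ and $s_2Rt_2$; for a relation $Q\subseteq X\times Y$, $U\,[\mathcal P Q]\,V$ iff every element of $U$ is $Q$-related to some element of $V$ and vice versa. -}

module Defs where

open import Data.Product using (Σ; _×_; _,_; ∃-syntax)
open import Data.Sum using (_⊎_)
open import Relation.Binary.PropositionalEquality using (_≡_)
open import Relation.Binary.Construct.Closure.ReflexiveTransitive using (Star)

data Act (L : Set) : Set where
  lab : L → Act L
  τ   : Act L

𝒫 : Set → Set₁
𝒫 X = X → Set

LTS : Set → Set → Set₁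
LTS L S = Act L → S → 𝒫 S

τ* : {L S : Set} → LTS L S → S → S → Set
τ* F = Star (F τ)

Rel : Set → Set → Set₁
Rel X Y = X → Y → Set

IsSemiBranchingBisim : {L S T : Set} → LTS L S → LTS L T → Rel S T → Set
IsSemiBranchingBisim {L} {S} {T} F G R =
  (∀ {s t} → R s t → ∀ (a : Act L) s' → F a s s' →
     (∃[ t₁ ] ∃[ t₂ ] (τ* G t t₁ × G a t₁ t₂ × R s t₁ × R s' t₂))
     ⊎ (a ≡ τ × ∃[ t' ] (τ* G t t' × R s t' × R s' t')))
  ×
  (∀ {s t} → R s t → ∀ (a : Act L) t' → G a t t' →
     (∃[ s₁ ] ∃[ s₂ ] (τ* F s s₁ × F a s₁ s₂ × R s₁ t × R s₂ t'))
     ⊎ (a ≡ τ × ∃[ s' ] (τ* F s s' × R s' t × R s' t')))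

sat : {L S : Set} → LTS L S → Act L → S → 𝒫 (S × S)
sat F a s (s₁ , s₂) =
  (τ* F s s₁ × F a s₁ s₂) ⊎ (a ≡ τ × s₁ ≡ s₂ × τ* F s s₁)

_×ᴿ_ : {X Y X' Y' : Set} → Rel X Y → Rel X' Y' → Rel (X × X') (Y × Y')
(R ×ᴿ R') (x , x') (y , y') = R x y × R' x' y'

𝒫ᴿ : {X Y : Set} → Rel X Y → 𝒫 X → 𝒫 Y → Set
𝒫ᴿ Q U V =
  (∀ x → U x → ∃[ y ] (V y × Q x y)) ×
  (∀ y → V y → ∃[ x ] (U x × Q x y))

InSatRel : {L S T : Set} → LTS L S → LTS L T → Rel S T → Set
InSatRel {L} F G R =
  ∀ (a : Act L) {s t} → R s t → 𝒫ᴿ (R ×ᴿ R) (sat F a s) (sat G a t)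

-- A semi-branching simulation step s -a-> s' is answered by a τ-path followed
-- by an a-step (or, for a = τ, by a τ-path alone), which is exactly an element
-- of the saturation G^sb(a)(t).  Conversely a saturated transition
-- s -τ*-> s₁ -a-> s₂ is matched by first following the τ-path one step at a
-- time and then answering the final a-step.  Applying this to R and to its
-- converse gives the two halves of both the bisimulation and the power relation.
module Submission where

open import Defs
open import Function.Base using (flip)
open import Function.Bundles using (_⇔_; mk⇔; Equivalence)
open import Data.Product using (_×_; _,_; ∃-syntax; proj₁; proj₂)
open import Data.Sum using (_⊎_; inj₁; inj₂)
open import Relation.Binary.PropositionalEquality using (_≡_; refl)
open import Relation.Binary.Construct.Closure.ReflexiveTransitive using (ε; _◅_; _◅◅_)

module _ {L S T : Set} (F : LTS L S) (G : LTS L T) (R : Rel S T) where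

  IsSemiBranchingSim : Set
  IsSemiBranchingSim = ∀ {s t} → R s t → ∀ (a : Act L) s' → F a s s' →
    (∃[ t₁ ] ∃[ t₂ ] (τ* G t t₁ × G a t₁ t₂ × R s t₁ × R s' t₂))
    ⊎ (a ≡ τ × ∃[ t' ] (τ* G t t' × R s t' × R s' t'))

  IsSatSim : Set
  IsSatSim = ∀ (a : Act L) {s t} → R s t →
    ∀ x → sat F a s x → ∃[ y ] (sat G a t y × (R ×ᴿ R) x y)

  semiBranchingSim-τ* : IsSemiBranchingSim → ∀ {s s₁ t} → R s t → τ* F s s₁ →
    ∃[ t₁ ] (τ* G t t₁ × R s₁ t₁)
  semiBranchingSim-τ* sim r ε = _ , ε , r
  semiBranchingSim-τ* sim r (step ◅ steps) with sim r τ _ step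
  ... | inj₁ (_ , _ , path , last , _ , r′)
    with t₁ , path′ , r₁ ← semiBranchingSim-τ* sim r′ steps
    = t₁ , path ◅◅ last ◅ path′ , r₁
  ... | inj₂ (_ , _ , path , _ , r′)
    with t₁ , path′ , r₁ ← semiBranchingSim-τ* sim r′ steps
    = t₁ , path ◅◅ path′ , r₁

  semiBranchingSim⇒satSim : IsSemiBranchingSim → IsSatSim
  semiBranchingSim⇒satSim sim a r (_ , s₂) (inj₁ (path , step))
    with t′ , path′ , r′ ← semiBranchingSim-τ* sim r path
    with sim r′ a s₂ step
  ... | inj₁ (t₁ , t₂ , path″ , step′ , r₁ , r₂) =
    (t₁ , t₂) , inj₁ (path′ ◅◅ path″ , step′) , r₁ , r₂
  ... | inj₂ (refl , t″ , path″ , r₁ , r₂) =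
    (t″ , t″) , inj₂ (refl , refl , path′ ◅◅ path″) , r₁ , r₂
  semiBranchingSim⇒satSim sim a r (_ , _) (inj₂ (a≡τ , refl , path))
    with t′ , path′ , r′ ← semiBranchingSim-τ* sim r path
    = (t′ , t′) , inj₂ (a≡τ , refl , path′) , r′ , r′

  satSim⇒semiBranchingSim : IsSatSim → IsSemiBranchingSim
  satSim⇒semiBranchingSim satSim r a s′ step
    with satSim a r (_ , s′) (inj₁ (ε , step))
  ... | (t₁ , t₂) , inj₁ (path , step′) , r₁ , r₂ = inj₁ (t₁ , t₂ , path , step′ , r₁ , r₂)
  ... | (t₁ , _) , inj₂ (a≡τ , refl , path) , r₁ , r₂ = inj₂ (a≡τ , t₁ , path , r₁ , r₂)

  semiBranchingSim⇔satSim : IsSemiBranchingSim ⇔ IsSatSim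
  semiBranchingSim⇔satSim = mk⇔ semiBranchingSim⇒satSim satSim⇒semiBranchingSim

mainTheorem4 : {L S T : Set} (F : LTS L S) (G : LTS L T) (R : Rel S T) →
    IsSemiBranchingBisim F G R ⇔ InSatRel F G R
mainTheorem4 F G R = mk⇔ to from
  where
  forth : IsSemiBranchingSim F G R ⇔ IsSatSim F G R
  forth = semiBranchingSim⇔satSim F G R

  back : IsSemiBranchingSim G F (flip R) ⇔ IsSatSim G F (flip R)
  back = semiBranchingSim⇔satSim G F (flip R)

  to : IsSemiBranchingBisim F G R → InSatRel F G R
  to (sim , sim⁻¹) a r =
    Equivalence.to forth sim a r , Equivalence.to back (λ {t} {s} → sim⁻¹ {s} {t}) a r

  from : InSatRel F G R → IsSemiBranchingBisim F G R
  from satRel =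
    Equivalence.from forth (λ a r → proj₁ (satRel a r)) ,
    (λ {s} {t} → Equivalence.from back (λ a r → proj₂ (satRel a r)) {t} {s})
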